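{- Let $\mathcal{E}=\{e\}$ be the trivial monoid. For any $k\ge0$, the clone $\mathsf{Inc}_k:=\mathbf{P}(\mathcal{E})/_{\equiv_{\phi_k}}$ admits the presentation $(\mathcal{G}_{\mathcal{E}},\mathcal{R}'_{\mathcal{E}})$, where $\mathcal{R}'_{\mathcal{E}}$ is the equivalence relation on $\mathbf{T}(\mathcal{G}_{\mathcal{E}})$ generated by $\mathcal{R}_{\mathcal{E}}$ together with the equations $\mathrm{rc}_{\mathcal{E}}(1^e2^e)\sim\mathrm{rc}_{\mathcal{E}}(2^e1^e)$ (arity $2$) and $\mathrm{rc}_{\mathcal{E}}((1^e)^{k+1})\sim\mathrm{rc}_{\mathcal{E}}((1^e)^k)$ (arity $1$).
   Context: Clones: a clone $C$ is a graded set with superposition maps $C(n)\times C(m)^n\to C(m)$, $x[y_1,\dots,y_n]$, and projections $\mathbf{1}_{i,n}$ satisfying $\mathbf{1}_{i,n}[y_1,\dots,y_n]=y_i$, $x[\mathbf{1}_{1,n},\dots,\mathbf{1}_{n,n}]=x$ and $x[y_1,\dots,y_n][z_1,\dots,z_m]=x[y_1[z_1,\dots,z_m],\dots,y_n[z_1,\dots,z_m]]$; clone congruences are arity-preserving equivalence relations compatible with superposition. $\mathbf{P}(\mathcal{E})(n)$ is the set of words on letters $i^e$, $i\in[n]$; $\mathbf{P}(\mathcal{E})$ is the clone with $i_1^e\cdots i_\ell^e[\mathfrak{p}_1,\dots,\mathfrak{p}_n]:=\mathfrak{p}_{i_1}\cdots\mathfrak{p}_{i_\ell}$ (concatenation)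 and projections $i^e$. $\phi_k(\mathfrak{p})$ is the weakly increasing word containing, for each value $i$, exactly $\min(k,|\mathfrak{p}|_i)$ letters $i^e$, where $|\mathfrak{p}|_i$ is the number of occurrences of $i^e$ in $\mathfrak{p}$ (i.e. $\phi_k$ keeps the first $k$ occurrences of each value and sorts); $\equiv_{\phi_k}$ relates words of equal arity with equal image under $\phi_k$; it is a clone congruence. Terms: $\mathbf{T}(\mathcal{G})(n)$ is the set of $\mathcal{G}$-terms with variables among $x_1,\dots,x_n$ (free clone: superposition = substitution, projections $x_i$). For $(\mathcal{G},\mathcal{R})$, $\equiv_{\mathcal{R}}$ is the smallest clone congruence containing $\mathcal{R}$; $(\mathcal{G},\mathcal{R})$ is a presentation of $C$ if $C\cong\mathbf{T}(\mathcal{G})/_{\equiv_{\mathcal{R}}}$. $\mathcal{G}_{\mathcal{E}}(0)=\{\mathsf{u}\}$, $\mathcal{G}_{\mathcal{E}}(1)=\{\mathsf{p}_e\}$, $\mathcal{G}_{\mathcal{E}}(2)=\{\star\}$; $\mathcal{R}_{\mathcal{E}}$ is generated by $\star[\star[x_1,x_2],x_3]\sim\star[x_1,\star[x_2,x_3]]$, $\star[\mathsf{u},x_1]\sim x_1\sim\star[x_1,\mathsf{u}]$, $\mathsf{p}_e[\star[x_1,x_2]]\sim\star[\mathsf{p}_e[x_1],\mathsf{p}_e[x_2]]$, $\mathsf{p}_e[\mathsf{u}]\sim\mathsf{u}$, $\mathsf{p}_e[\mathsf{p}_e[x_1]]\sim\mathsf{p}_e[x_1]$, $\mathsf{p}_e[x_1]\sim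 x_1$. Right comb map: $\mathrm{rc}_{\mathcal{E}}(\epsilon)=\mathsf{u}$, $\mathrm{rc}_{\mathcal{E}}(i^e\mathfrak{p}')=\star[\mathsf{p}_e[x_i],\mathrm{rc}_{\mathcal{E}}(\mathfrak{p}')]$; $(1^e)^k$ denotes the word of $k$ letters $1^e$. -}

module Defs where

open import Data.Nat using (ℕ; zero; suc; _⊓_)
open import Data.Fin using (Fin; zero; suc)
open import Data.Fin.Properties using (_≟_)
open import Data.List using (List; []; _∷_; _++_; concatMap; replicate; length; filter; allFin)
open import Relation.Binary.PropositionalEquality using (_≡_)

-- The trivial monoid E = {e}: a letter i^e is determined by i ∈ [n] = Fin n.
-- P(E)(n): words on the letters i^e, i.e. lists over Fin n.
Word : ℕ → Set
Word n = List (Fin n)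

_[_]w : ∀ {n m} → Word n → (Fin n → Word m) → Word m
w [ ps ]w = concatMap ps w

count : ∀ {n} → Fin n → Word n → ℕ
count i w = length (filter (_≟ i) w)

φ : (k : ℕ) → ∀ {n} → Word n → Word n
φ k {n} w = concatMap (λ i → replicate (k ⊓ count i w) i) (allFin n)

_≡φ[_]_ : ∀ {n} → Word n → ℕ → Word n → Set
w ≡φ[ k ] w' = φ k w ≡ φ k w'

data Term (n : ℕ) : Set where
  var : Fin n → Term n
  u   : Term n
  p   : Term n → Term n
  _⋆_ : Term n → Term n → Term n

sub : ∀ {n m} → Term n → (Fin n → Term m) → Term m
sub (var i) s = s i
sub u s = u
sub (p t) s = p (sub t s)
sub (t ⋆ t') s = sub t s ⋆ sub t' s

x₁ : ∀ {n} → Term (suc n)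
x₁ = var zero
x₂ : ∀ {n} → Term (suc (suc n))
x₂ = var (suc zero)
x₃ : ∀ {n} → Term (suc (suc (suc n)))
x₃ = var (suc (suc zero))

rc : ∀ {n} → Word n → Term n
rc [] = u
rc (i ∷ w) = p (var i) ⋆ rc w

-- ≡_{R'_E}: the smallest clone congruence on T(G_E) containing R_E and the
-- two extra equations.  R' k n t t' : t ≡_{R'_E} t' in arity n (k is the parameter).
data R' (k : ℕ) : (n : ℕ) → Term n → Term n → Set where
  assoc  : R' k 3 ((x₁ ⋆ x₂) ⋆ x₃) (x₁ ⋆ (x₂ ⋆ x₃))
  unitˡ  : R' k 1 (u ⋆ x₁) x₁
  unitʳ  : R' k 1 (x₁ ⋆ u) x₁
  p-⋆    : R' k 2 (p (x₁ ⋆ x₂)) (p x₁ ⋆ p x₂)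
  p-u    : R' k 0 (p u) u
  p-p    : R' k 1 (p (p x₁)) (p x₁)
  p-e    : R' k 1 (p x₁) x₁
  comm   : R' k 2 (rc (zero ∷ suc zero ∷ [])) (rc (suc zero ∷ zero ∷ []))
  trunc  : R' k 1 (rc (replicate (suc k) zero)) (rc (replicate k zero))
  refl′  : ∀ {n} {t : Term n} → R' k n t t
  sym′   : ∀ {n} {t t' : Term n} → R' k n t t' → R' k n t' t
  trans′ : ∀ {n} {t t' t'' : Term n} → R' k n t t' → R' k n t' t'' → R' k n t t''
  super  : ∀ {n m} {t t' : Term n} {s s' : Fin n → Term m} →
           R' k n t t' → (∀ i → R' k m (s i) (s' i)) → R' k m (sub t s) (sub t' s')

{-# OPTIONS --safe #-}
-- Flattening a term (forgetting u, p and the bracketing of ⋆) is a clone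
-- morphism onto P(E), and R_E alone makes every term equal to the right comb
-- of its flattening.  On words, the two extra relations generate the
-- congruence ≈ spanned by swapping two adjacent letters and replacing k+1
-- copies of a letter by k.  This is exactly ≡_{φ_k}: ≈ preserves each
-- truncated count min(k, |w|_i), and sorting followed by truncation shows
-- w ≈ φ_k(w).

module Submission where

open import Defs
open import Data.Nat using (ℕ; zero; suc; _+_; _⊓_; _≤_)
open import Data.Nat.Properties
  using ( +-comm; ≤-total; ≤-trans; m≤n+m; m≤n⇒m⊓n≡m; m≥n⇒m⊓n≡n; m⊓n≤m; ⊓-zeroʳ; ⊓-idem
        ; n≤1+n; m≤n⇒m<n∨m≡n )
open import Data.Fin using (Fin; zero; suc)
open import Data.Fin.Properties using (_≟_; suc-injective)
open import Data.List using ([]; _∷_; _++_; concat; concatMap; replicate; tabulate; filter; length; allFin)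
open import Data.List.Properties
  using ( ++-assoc; ++-identityʳ; length-++; filter-++; filter-accept; filter-reject
        ; concatMap-++; concatMap-cong; map-tabulate; map-replicate )
import Data.Vec.Functional as Vec
open import Data.Product using (Σ; ∃; _×_; _,_)
open import Data.Sum using (inj₁; inj₂)
open import Function using (_∘_; _⇔_; mk⇔; id; const; case_of_)
open import Relation.Binary.Bundles using (Setoid)
open import Relation.Binary.PropositionalEquality
  using (_≡_; _≢_; refl; sym; trans; cong; cong₂; subst₂; module ≡-Reasoning)
import Relation.Binary.Reasoning.Setoid as SetoidReasoning
open import Relation.Nullary using (yes; no)

count-++ : ∀ {n} (l : Fin n) a b → count l (a ++ b) ≡ count l a + count l b
count-++ l a b = trans (cong length (filter-++ (_≟ l) a b)) (length-++ (filter (_≟ l) a))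

count-∷-≡ : ∀ {n} (l : Fin n) w → count l (l ∷ w) ≡ suc (count l w)
count-∷-≡ l w = cong length (filter-accept (_≟ l) refl)

count-∷-≢ : ∀ {n} {l i : Fin n} w → i ≢ l → count l (i ∷ w) ≡ count l w
count-∷-≢ w i≢l = cong length (filter-reject (_≟ _) i≢l)

count-replicate-≡ : ∀ {n} (l : Fin n) m → count l (replicate m l) ≡ m
count-replicate-≡ l zero    = refl
count-replicate-≡ l (suc m) = trans (count-∷-≡ l _) (cong suc (count-replicate-≡ l m))

count-replicate-≢ : ∀ {n} {l i : Fin n} m → i ≢ l → count l (replicate m i) ≡ 0
count-replicate-≢ zero    i≢l = refl
count-replicate-≢ (suc m) i≢l = trans (count-∷-≢ _ i≢l) (count-replicate-≢ m i≢l)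

⊓-+-truncʳ : ∀ k a b → k ⊓ (a + b) ≡ k ⊓ (a + k ⊓ b)
⊓-+-truncʳ k a b with ≤-total k b
... | inj₁ k≤b = begin
  k ⊓ (a + b)      ≡⟨ m≤n⇒m⊓n≡m (≤-trans k≤b (m≤n+m b a)) ⟩
  k                ≡⟨ m≤n⇒m⊓n≡m (m≤n+m k a) ⟨
  k ⊓ (a + k)      ≡⟨ cong (λ c → k ⊓ (a + c)) (m≤n⇒m⊓n≡m k≤b) ⟨
  k ⊓ (a + k ⊓ b)  ∎
  where open ≡-Reasoning
... | inj₂ b≤k = cong (λ c → k ⊓ (a + c)) (sym (m≥n⇒m⊓n≡n b≤k))

⊓-+-trunc : ∀ k a b → k ⊓ (a + b) ≡ k ⊓ (k ⊓ a + k ⊓ b)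
⊓-+-trunc k a b = begin
  k ⊓ (a + b)              ≡⟨ ⊓-+-truncʳ k a b ⟩
  k ⊓ (a + k ⊓ b)          ≡⟨ cong (k ⊓_) (+-comm a (k ⊓ b)) ⟩
  k ⊓ (k ⊓ b + a)          ≡⟨ ⊓-+-truncʳ k (k ⊓ b) a ⟩
  k ⊓ (k ⊓ b + k ⊓ a)      ≡⟨ cong (k ⊓_) (+-comm (k ⊓ b) (k ⊓ a)) ⟩
  k ⊓ (k ⊓ a + k ⊓ b)      ∎
  where open ≡-Reasoning

⊓-+-cong : ∀ k {a a' b b'} →
           k ⊓ a ≡ k ⊓ a' → k ⊓ b ≡ k ⊓ b' → k ⊓ (a + b) ≡ k ⊓ (a' + b')
⊓-+-cong k {a} {a'} {b} {b'} eqa eqb =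
  trans (⊓-+-trunc k a b) (trans (cong₂ (λ x y → k ⊓ (x + y)) eqa eqb) (sym (⊓-+-trunc k a' b')))

⊓-count-replicate-suc : ∀ k {n} (l i : Fin n) →
                        k ⊓ count l (replicate (suc k) i) ≡ k ⊓ count l (replicate k i)
⊓-count-replicate-suc k l i = case i ≟ l of λ where
    (yes refl) → begin
      k ⊓ count i (replicate (suc k) i)  ≡⟨ cong (k ⊓_) (count-replicate-≡ i (suc k)) ⟩
      k ⊓ suc k                          ≡⟨ m≤n⇒m⊓n≡m (n≤1+n k) ⟩
      k                                  ≡⟨ ⊓-idem k ⟨
      k ⊓ k                              ≡⟨ cong (k ⊓_) (count-replicate-≡ i k) ⟨
      k ⊓ count i (replicate k i)        ∎
    (no i≢l) → cong (k ⊓_) (trans (count-replicate-≢ (suc k) i≢l) (sym (count-replicate-≢ k i≢l)))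
  where open ≡-Reasoning

replicates : ∀ {n N} → (Fin n → ℕ) → (Fin n → Fin N) → Word N
replicates c g = concat (tabulate (λ i → replicate (c i) (g i)))

replicates-zero : ∀ {n N} (g : Fin n → Fin N) → replicates (const 0) g ≡ []
replicates-zero {zero}  g = refl
replicates-zero {suc n} g = replicates-zero (g ∘ suc)

φ-replicates : ∀ k {n} (w : Word n) → φ k w ≡ replicates (λ i → k ⊓ count i w) id
φ-replicates k w = cong concat (map-tabulate id (λ i → replicate (k ⊓ count i w) i))

flatten : ∀ {n} → Term n → Word n
flatten (var i)  = i ∷ []
flatten u        = []
flatten (p t)    = flatten t
flatten (t ⋆ t') = flatten t ++ flatten t'

flatten-sub : ∀ {n m} (t : Term n) (s : Fin n → Term m) →
              flatten (sub t s) ≡ flatten t [ flatten ∘ s ]w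
flatten-sub (var i)  s = sym (++-identityʳ (flatten (s i)))
flatten-sub u        s = refl
flatten-sub (p t)    s = flatten-sub t s
flatten-sub (t ⋆ t') s =
  trans (cong₂ _++_ (flatten-sub t s) (flatten-sub t' s)) (sym (concatMap-++ (flatten ∘ s) (flatten t) (flatten t')))

flatten-rc : ∀ {n} (w : Word n) → flatten (rc w) ≡ w
flatten-rc []      = refl
flatten-rc (i ∷ w) = cong (i ∷_) (flatten-rc w)

sub-rc-replicate : ∀ {n} (i : Fin n) m →
                   sub (rc {1} (replicate m zero)) (const (var i)) ≡ rc (replicate m i)
sub-rc-replicate i zero    = refl
sub-rc-replicate i (suc m) = cong (p (var i) ⋆_) (sub-rc-replicate i m)

module _ (k : ℕ) where

  infix  4 _≈_
  infixr 5 _++-cong_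
  data _≈_ {n} : Word n → Word n → Set where
    swap      : ∀ i j → i ∷ j ∷ [] ≈ j ∷ i ∷ []
    truncate  : ∀ i → replicate (suc k) i ≈ replicate k i
    _++-cong_ : ∀ {a a' b b'} → a ≈ a' → b ≈ b' → a ++ b ≈ a' ++ b'
    ≈-refl    : ∀ {a} → a ≈ a
    ≈-sym     : ∀ {a b} → a ≈ b → b ≈ a
    ≈-trans   : ∀ {a b c} → a ≈ b → b ≈ c → a ≈ c

  ≈-setoid : ℕ → Setoid _ _
  ≈-setoid n = record
    { Carrier = Word n ; _≈_ = _≈_
    ; isEquivalence = record { refl = ≈-refl ; sym = ≈-sym ; trans = ≈-trans } }

  ≡⇒≈ : ∀ {n} {a b : Word n} → a ≡ b → a ≈ b
  ≡⇒≈ refl = ≈-refl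

  ∷-cong : ∀ {n} (i : Fin n) {a b} → a ≈ b → i ∷ a ≈ i ∷ b
  ∷-cong i e = ≈-refl {a = i ∷ []} ++-cong e

  shift-∷ : ∀ {n} (a : Word n) x b → a ++ x ∷ b ≈ x ∷ a ++ b
  shift-∷ []      x b = ≈-refl
  shift-∷ (c ∷ a) x b = ≈-trans (∷-cong c (shift-∷ a x b)) (swap c x ++-cong ≈-refl)

  ++-comm-≈ : ∀ {n} (a b : Word n) → a ++ b ≈ b ++ a
  ++-comm-≈ []      b = ≡⇒≈ (sym (++-identityʳ b))
  ++-comm-≈ (c ∷ a) b = ≈-trans (∷-cong c (++-comm-≈ a b)) (≈-sym (shift-∷ b c a))

  ++-exchange-≈ : ∀ {n} (a b c : Word n) → a ++ (b ++ c) ≈ b ++ (a ++ c)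
  ++-exchange-≈ a b c = begin
    a ++ (b ++ c)  ≡⟨ ++-assoc a b c ⟨
    (a ++ b) ++ c  ≈⟨ ++-comm-≈ a b ++-cong ≈-refl ⟩
    (b ++ a) ++ c  ≡⟨ ++-assoc b a c ⟩
    b ++ (a ++ c)  ∎
    where open SetoidReasoning (≈-setoid _)

  concat-replicate-∷ : ∀ {n} m (c : Fin n) x →
                       concat (replicate m (c ∷ x)) ≈ replicate m c ++ concat (replicate m x)
  concat-replicate-∷ zero    c x = ≈-refl
  concat-replicate-∷ (suc m) c x =
    ∷-cong c (≈-trans (≈-refl {a = x} ++-cong concat-replicate-∷ m c x)
                      (++-exchange-≈ x (replicate m c) (concat (replicate m x))))

  concat-replicate-truncate : ∀ {n} (x : Word n) → concat (replicate (suc k) x) ≈ concat (replicate k x)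
  concat-replicate-truncate []      = ≈-refl
  concat-replicate-truncate (c ∷ x) = begin
    concat (replicate (suc k) (c ∷ x))                    ≈⟨ concat-replicate-∷ (suc k) c x ⟩
    replicate (suc k) c ++ concat (replicate (suc k) x)   ≈⟨ truncate c ++-cong concat-replicate-truncate x ⟩
    replicate k c ++ concat (replicate k x)               ≈⟨ concat-replicate-∷ k c x ⟨
    concat (replicate k (c ∷ x))                          ∎
    where open SetoidReasoning (≈-setoid _)

  ≈-[]wˡ : ∀ {n m} (ps : Fin n → Word m) {a b} → a ≈ b → a [ ps ]w ≈ b [ ps ]w
  ≈-[]wˡ ps (swap i j)     = ++-exchange-≈ (ps i) (ps j) []
  ≈-[]wˡ ps (truncate i)   = begin
    concatMap ps (replicate (suc k) i)  ≡⟨ cong concat (map-replicate ps (suc k) i) ⟩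
    concat (replicate (suc k) (ps i))   ≈⟨ concat-replicate-truncate (ps i) ⟩
    concat (replicate k (ps i))         ≡⟨ cong concat (map-replicate ps k i) ⟨
    concatMap ps (replicate k i)        ∎
    where open SetoidReasoning (≈-setoid _)
  ≈-[]wˡ ps (_++-cong_ {a} {a'} {b} {b'} e e') = begin
    concatMap ps (a ++ b)                 ≡⟨ concatMap-++ ps a b ⟩
    concatMap ps a ++ concatMap ps b      ≈⟨ ≈-[]wˡ ps e ++-cong ≈-[]wˡ ps e' ⟩
    concatMap ps a' ++ concatMap ps b'    ≡⟨ concatMap-++ ps a' b' ⟨
    concatMap ps (a' ++ b')               ∎
    where open SetoidReasoning (≈-setoid _)
  ≈-[]wˡ ps ≈-refl         = ≈-refl
  ≈-[]wˡ ps (≈-sym e)      = ≈-sym (≈-[]wˡ ps e)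
  ≈-[]wˡ ps (≈-trans e e') = ≈-trans (≈-[]wˡ ps e) (≈-[]wˡ ps e')

  ≈-[]wʳ : ∀ {n m} (w : Word n) {ps ps' : Fin n → Word m} →
           (∀ i → ps i ≈ ps' i) → w [ ps ]w ≈ w [ ps' ]w
  ≈-[]wʳ []      e = ≈-refl
  ≈-[]wʳ (i ∷ w) e = e i ++-cong ≈-[]wʳ w e

  ≈⇒⊓-count : ∀ {n} {a b : Word n} → a ≈ b → ∀ l → k ⊓ count l a ≡ k ⊓ count l b
  ≈⇒⊓-count (swap i j) l =
    cong (k ⊓_) (trans (count-++ l (i ∷ []) (j ∷ []))
                (trans (+-comm (count l (i ∷ [])) (count l (j ∷ []))) (sym (count-++ l (j ∷ []) (i ∷ [])))))
  ≈⇒⊓-count (truncate i) l = ⊓-count-replicate-suc k l i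
  ≈⇒⊓-count (_++-cong_ {a} {a'} {b} {b'} e e') l =
    trans (cong (k ⊓_) (count-++ l a b))
          (trans (⊓-+-cong k (≈⇒⊓-count e l) (≈⇒⊓-count e' l)) (cong (k ⊓_) (sym (count-++ l a' b'))))
  ≈⇒⊓-count ≈-refl         l = refl
  ≈⇒⊓-count (≈-sym e)      l = sym (≈⇒⊓-count e l)
  ≈⇒⊓-count (≈-trans e e') l = trans (≈⇒⊓-count e l) (≈⇒⊓-count e' l)

  ≈⇒≡φ : ∀ {n} {a b : Word n} → a ≈ b → a ≡φ[ k ] b
  ≈⇒≡φ e = concatMap-cong (λ i → cong (λ r → replicate r i) (≈⇒⊓-count e i)) (allFin _)

  concat-tabulate-≈ : ∀ {n N} {f f' : Fin n → Word N} →
                      (∀ i → f i ≈ f' i) → concat (tabulate f) ≈ concat (tabulate f')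
  concat-tabulate-≈ {zero}  e = ≈-refl
  concat-tabulate-≈ {suc n} e = e zero ++-cong concat-tabulate-≈ (e ∘ suc)

  replicates-suc : ∀ {n N} (g : Fin n → Fin N) {c c' : Fin n → ℕ} j →
                   c' j ≡ suc (c j) → (∀ i → i ≢ j → c' i ≡ c i) →
                   replicates c' g ≈ g j ∷ replicates c g
  replicates-suc g zero    hit miss =
    ≡⇒≈ (cong (λ r → replicate r (g zero)) hit)
      ++-cong concat-tabulate-≈ (λ i → ≡⇒≈ (cong (λ r → replicate r (g (suc i))) (miss (suc i) λ ())))
  replicates-suc g {c} (suc j) hit miss =
    ≈-trans (≡⇒≈ (cong (λ r → replicate r (g zero)) (miss zero λ ()))
               ++-cong replicates-suc (g ∘ suc) j hit (λ i i≢j → miss (suc i) (i≢j ∘ suc-injective)))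
            (shift-∷ (replicate (c zero) (g zero)) (g (suc j)) _)

  ≈-sorted : ∀ {n} (w : Word n) → w ≈ replicates (λ i → count i w) id
  ≈-sorted []      = ≡⇒≈ (sym (replicates-zero id))
  ≈-sorted (j ∷ w) = ≈-trans (∷-cong j (≈-sorted w))
    (≈-sym (replicates-suc id j (count-∷-≡ j w) (λ i i≢j → count-∷-≢ w (i≢j ∘ sym))))

  replicate-≈-⊓ : ∀ {n} (i : Fin n) c → replicate c i ≈ replicate (k ⊓ c) i
  replicate-≈-⊓ i zero    = ≡⇒≈ (cong (λ r → replicate r i) (sym (⊓-zeroʳ k)))
  replicate-≈-⊓ i (suc c) = begin
    i ∷ replicate c i              ≈⟨ ∷-cong i (replicate-≈-⊓ i c) ⟩
    replicate (suc (k ⊓ c)) i      ≈⟨ replicate-suc-≈-⊓ (m⊓n≤m k c) ⟩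
    replicate (k ⊓ suc (k ⊓ c)) i  ≡⟨ cong (λ r → replicate r i) (⊓-+-truncʳ k 1 c) ⟨
    replicate (k ⊓ suc c) i        ∎
    where
    open SetoidReasoning (≈-setoid _)
    replicate-suc-≈-⊓ : ∀ {m} → m ≤ k → replicate (suc m) i ≈ replicate (k ⊓ suc m) i
    replicate-suc-≈-⊓ m≤k with m≤n⇒m<n∨m≡n m≤k
    ... | inj₁ m<k  = ≡⇒≈ (cong (λ r → replicate r i) (sym (m≥n⇒m⊓n≡n m<k)))
    ... | inj₂ refl = ≈-trans (truncate i) (≡⇒≈ (cong (λ r → replicate r i) (sym (m≤n⇒m⊓n≡m (n≤1+n k)))))

  ≈-φ : ∀ {n} (w : Word n) → w ≈ φ k w
  ≈-φ w = begin
    w                                       ≈⟨ ≈-sorted w ⟩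
    replicates (λ i → count i w) id         ≈⟨ concat-tabulate-≈ (λ i → replicate-≈-⊓ i (count i w)) ⟩
    replicates (λ i → k ⊓ count i w) id     ≡⟨ φ-replicates k w ⟨
    φ k w                                   ∎
    where open SetoidReasoning (≈-setoid _)

  ≡φ⇒≈ : ∀ {n} {a b : Word n} → a ≡φ[ k ] b → a ≈ b
  ≡φ⇒≈ {a = a} {b} eq = ≈-trans (≈-φ a) (≈-trans (≡⇒≈ eq) (≈-sym (≈-φ b)))

  R'⇒≈ : ∀ {n} {t t' : Term n} → R' k n t t' → flatten t ≈ flatten t'
  R'⇒≈ assoc  = ≈-refl
  R'⇒≈ unitˡ  = ≈-refl
  R'⇒≈ unitʳ  = ≈-refl
  R'⇒≈ p-⋆    = ≈-refl
  R'⇒≈ p-u    = ≈-refl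
  R'⇒≈ p-p    = ≈-refl
  R'⇒≈ p-e    = ≈-refl
  R'⇒≈ comm   = swap zero (suc zero)
  R'⇒≈ trunc  = subst₂ _≈_ (sym (flatten-rc _)) (sym (flatten-rc _)) (truncate zero)
  R'⇒≈ refl′  = ≈-refl
  R'⇒≈ (sym′ r)      = ≈-sym (R'⇒≈ r)
  R'⇒≈ (trans′ r r') = ≈-trans (R'⇒≈ r) (R'⇒≈ r')
  R'⇒≈ (super {t = t} {t'} {s} {s'} r rs) = begin
    flatten (sub t s)                ≡⟨ flatten-sub t s ⟩
    flatten t [ flatten ∘ s ]w       ≈⟨ ≈-[]wˡ (flatten ∘ s) (R'⇒≈ r) ⟩
    flatten t' [ flatten ∘ s ]w      ≈⟨ ≈-[]wʳ (flatten t') (R'⇒≈ ∘ rs) ⟩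
    flatten t' [ flatten ∘ s' ]w     ≡⟨ flatten-sub t' s' ⟨
    flatten (sub t' s')              ∎
    where open SetoidReasoning (≈-setoid _)

  instantiate : ∀ {n m} {t t' : Term n} →
                R' k n t t' → (s : Fin n → Term m) → R' k m (sub t s) (sub t' s)
  instantiate r s = super r (λ _ → refl′)

  ⋆-cong : ∀ {n} {a a' b b' : Term n} → R' k n a a' → R' k n b b' → R' k n (a ⋆ b) (a' ⋆ b')
  ⋆-cong {a = a} {a'} {b} {b'} ra rb =
    super {t = x₁ ⋆ x₂} {s = a Vec.∷ b Vec.∷ Vec.[]} {s' = a' Vec.∷ b' Vec.∷ Vec.[]} refl′
          λ { zero → ra ; (suc zero) → rb }

  rc-++ : ∀ {n} (a b : Word n) → R' k n (rc a ⋆ rc b) (rc (a ++ b))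
  rc-++ []      b = instantiate unitˡ (const (rc b))
  rc-++ (i ∷ a) b =
    trans′ (instantiate assoc (p (var i) Vec.∷ rc a Vec.∷ rc b Vec.∷ Vec.[])) (⋆-cong refl′ (rc-++ a b))

  R'-rc-flatten : ∀ {n} (t : Term n) → R' k n t (rc (flatten t))
  R'-rc-flatten (var i)  =
    sym′ (trans′ (instantiate unitʳ (const (p (var i)))) (instantiate p-e (const (var i))))
  R'-rc-flatten u        = refl′
  R'-rc-flatten (p t)    = trans′ (instantiate p-e (const t)) (R'-rc-flatten t)
  R'-rc-flatten (t ⋆ t') =
    trans′ (⋆-cong (R'-rc-flatten t) (R'-rc-flatten t')) (rc-++ (flatten t) (flatten t'))

  ≈⇒R'-rc : ∀ {n} {a b : Word n} → a ≈ b → R' k n (rc a) (rc b)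
  ≈⇒R'-rc (swap i j)     = instantiate comm (var i Vec.∷ var j Vec.∷ Vec.[])
  ≈⇒R'-rc (truncate i)   =
    subst₂ (R' k _) (sub-rc-replicate i (suc k)) (sub-rc-replicate i k) (instantiate trunc (const (var i)))
  ≈⇒R'-rc (_++-cong_ {a} {a'} {b} {b'} e e') =
    trans′ (sym′ (rc-++ a b)) (trans′ (⋆-cong (≈⇒R'-rc e) (≈⇒R'-rc e')) (rc-++ a' b'))
  ≈⇒R'-rc ≈-refl         = refl′
  ≈⇒R'-rc (≈-sym e)      = sym′ (≈⇒R'-rc e)
  ≈⇒R'-rc (≈-trans e e') = trans′ (≈⇒R'-rc e) (≈⇒R'-rc e')

  ≡φ⇒R' : ∀ {n} {t t' : Term n} → flatten t ≡φ[ k ] flatten t' → R' k n t t'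
  ≡φ⇒R' {t = t} {t'} eq =
    trans′ (R'-rc-flatten t) (trans′ (≈⇒R'-rc (≡φ⇒≈ eq)) (sym′ (R'-rc-flatten t')))

proposition4p3p3 : (k : ℕ) →
    Σ ((n : ℕ) → Term n → Word n) λ f →
      (∀ {n} (i : Fin n) → f n (var i) ≡φ[ k ] (i ∷ [])) ×
      (∀ {n m} (t : Term n) (s : Fin n → Term m) →
        f m (sub t s) ≡φ[ k ] (f n t [ f m ∘ s ]w)) ×
      (∀ {n} (w : Word n) → ∃ λ t → f n t ≡φ[ k ] w) ×
      (∀ {n} (t t' : Term n) → (f n t ≡φ[ k ] f n t') ⇔ R' k n t t')
proposition4p3p3 k =
  (λ _ → flatten) ,
  (λ _ → refl) ,
  (λ t s → cong (φ k) (flatten-sub t s)) ,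
  (λ w → rc w , cong (φ k) (flatten-rc w)) ,
  (λ t t' → mk⇔ (≡φ⇒R' k) (≈⇒≡φ k ∘ R'⇒≈ k))
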